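{- For every integer $k\ge 0$, with $n=2^k$, $|CS(k)| \ge 2^{n}\left(1-\frac{1}{n/2}\right) = 2^{2^k}\left(1-\frac{1}{2^{k-1}}\right)$.
   Context: $\mu$ is the morphism on binary words with $\mu(0)=01$, $\mu(1)=10$; $\mu^n$ is its $n$-fold iterate. Words $CS(k)$, $k\ge 0$, are defined recursively: $CS(0)=0$ (the one-letter word). For $k\ge 1$, let $n=2^k$, $m=2^{k-1}$, $X=\mu^n(0)$, $Y=\mu^n(1)$, and write $X=x_0x_1\cdots x_{2^m-1}$, $Y=y_0y_1\cdots y_{2^m-1}$ as concatenations of $2^m$ consecutive blocks of length $2^m$ (each block is $\mu^m(0)$ or $\mu^m(1)$). For $0\le i<2^m-1$ define $cs_i=x_i$ if $i$ is even; if $i$ is odd, $cs_i=x_i$ when $x_i=y_{i+1}$ and $cs_i=CS(k-1)$ otherwise. Then $CS(k)=cs_0cs_1\cdots cs_{2^m-2}$, which is a common subsequence of $\mu^{2^k}(0)$ and $\mu^{2^k}(1)$; $|CS(k)|$ denotes its length. -}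

module Defs where

open import Data.Bool using (Bool; true; false)
open import Data.Bool.Properties using () renaming (_≟_ to _≟ᵇ_)
open import Data.Nat using (ℕ; zero; suc; _^_)
open import Data.List using (List; []; _∷_; _++_; concatMap; concat; take; drop; zip; length)
open import Data.List.Properties using (≡-dec)
open import Data.Product using (_×_; _,_)
open import Relation.Nullary using (yes; no)

-- Binary words: List Bool, with false = letter 0 and true = letter 1.
Word : Set
Word = List Bool

μ₁ : Bool → Word
μ₁ false = false ∷ true ∷ []
μ₁ true  = true ∷ false ∷ []

μ : Word → Word
μ = concatMap μ₁

μ^ : ℕ → Word → Word
μ^ zero    w = w
μ^ (suc n) w = μ (μ^ n w)

blocks : ℕ → ℕ → Word → List Word
blocks b zero    w = []
blocks b (suc c) w = take b w ∷ blocks b c (drop b w)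

-- Given the recursive word r = CS(k-1), the starting index i (with its parity
-- tracked by the Bool `even`), and the list of pairs (x_i , y_{i+1}),
-- produce the list of pieces cs_i.
pieces : Word → Bool → List (Word × Word) → List Word
pieces r even [] = []
pieces r true  ((x , y) ∷ ps) = x ∷ pieces r false ps
pieces r false ((x , y) ∷ ps) with ≡-dec _≟ᵇ_ x y
... | yes _ = x ∷ pieces r true ps
... | no  _ = r ∷ pieces r true ps

-- CS(k).  For k = suc j:  n = 2^(suc j), m = 2^j, blocks of length 2^m,
-- 2^m blocks;  zip X-blocks with the Y-blocks shifted by one gives exactly
-- the pairs (x_i , y_{i+1}) for 0 ≤ i < 2^m - 1.
CS : ℕ → Word
CS zero    = false ∷ []
CS (suc j) =
  concat (pieces (CS j) true
    (zip (blocks (2 ^ m) (2 ^ m) X) (drop 1 (blocks (2 ^ m) (2 ^ m) Y))))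
  where
    n = 2 ^ suc j
    m = 2 ^ j
    X = μ^ n (false ∷ [])
    Y = μ^ n (true ∷ [])

module Submission where

-- Write m = 2^j, M = 2^m (the block length at level j+1) and
-- R = |CS(j)|.  Since μ^(2^(j+1))(0) = μ^m(μ^m(0)), the blocks x_i of X are
-- the images μ^m(t_i) of the letters of the Thue–Morse word t = μ^m(0), and
-- the blocks y_i of Y are μ^m(¬t_i); hence x_i = y_{i+1} iff t_i ≠ t_{i+1}.
-- So |CS(j+1)| is an explicit cost of t: M for each even position, and M
-- or R for each odd position according as t_i ≠ t_{i+1} or not.  Cutting t
-- into the 8-letter blocks μ³(a) = a ā ā a ā a a ā shows that each block
-- costs at least 5M + 2R + ℓ for any ℓ ≤ min(M, R), whence
--         M · (5M + 2R + ℓ) ≤ 8 · (|CS(j+1)| + ℓ).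
-- With this we prove by induction the cleared-denominator bound
--         n · 2^n ≤ n · |CS(k)| + 2 · 2^n          (n = 2^k),
-- taking ℓ = M when M ≤ R, and ℓ = R together with the induction hypothesis
-- otherwise; the base cases k ≤ 2 are computed.  Finally this bound is
-- transported to the rational inequality of the theorem.

open import Defs
open import Data.Nat using (ℕ; _^_)
open import Data.Nat.Properties using (m^n≢0)
open import Data.List using (length)

module LowerBound where
  open import Data.Bool using (Bool; true; false; not; _xor_; if_then_else_)
  open import Data.Bool.Properties using () renaming (_≟_ to _≟ᵇ_)
  open import Data.Nat
  open import Data.Nat.Properties
  open import Data.Nat.Tactic.RingSolver using (solve-∀)
  open import Data.List using (List; []; _∷_; _++_; [_]; concat; concatMap; map; take; drop; zip; head)
  open import Data.List.Properties using (≡-dec; concatMap-++; length-++; length-map)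
  open import Data.Product using (_×_; _,_)
  open import Relation.Nullary using (¬_; yes; no)
  open import Relation.Nullary.Decidable using (toWitness)
  open import Relation.Binary.PropositionalEquality hiding ([_])
  open import Data.Empty using (⊥-elim)

  -- The iterates of the Thue–Morse morphism

  μ^-[] : ∀ n → μ^ n [] ≡ []
  μ^-[] zero    = refl
  μ^-[] (suc n) = cong μ (μ^-[] n)

  μ^-++ : ∀ n u v → μ^ n (u ++ v) ≡ μ^ n u ++ μ^ n v
  μ^-++ zero    u v = refl
  μ^-++ (suc n) u v =
    trans (cong μ (μ^-++ n u v)) (concatMap-++ μ₁ (μ^ n u) (μ^ n v))

  μ^-+ : ∀ a b w → μ^ (a + b) w ≡ μ^ a (μ^ b w)
  μ^-+ zero    b w = refl
  μ^-+ (suc a) b w = cong μ (μ^-+ a b w)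

  block : ℕ → Bool → Word
  block n a = μ^ n [ a ]

  μ^-letterwise : ∀ n w → μ^ n w ≡ concatMap (block n) w
  μ^-letterwise n []      = μ^-[] n
  μ^-letterwise n (a ∷ w) = trans (μ^-++ n [ a ] w) (cong (block n a ++_) (μ^-letterwise n w))

  length-μ : ∀ w → length (μ w) ≡ 2 * length w
  length-μ []      = refl
  length-μ (a ∷ w) =
    trans (two-letters a (μ w)) (trans (cong (2 +_) (length-μ w)) (sym (*-suc 2 (length w))))
    where
    two-letters : ∀ a v → length (μ₁ a ++ v) ≡ 2 + length v
    two-letters false v = refl
    two-letters true  v = refl

  length-μ^ : ∀ n w → length (μ^ n w) ≡ 2 ^ n * length w
  length-μ^ zero    w = sym (*-identityˡ (length w))
  length-μ^ (suc n) w = begin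
    length (μ (μ^ n w))      ≡⟨ length-μ (μ^ n w) ⟩
    2 * length (μ^ n w)      ≡⟨ cong (2 *_) (length-μ^ n w) ⟩
    2 * (2 ^ n * length w)   ≡⟨ sym (*-assoc 2 (2 ^ n) (length w)) ⟩
    2 ^ suc n * length w     ∎
    where open ≡-Reasoning

  length-block : ∀ n a → length (block n a) ≡ 2 ^ n
  length-block n a = trans (length-μ^ n [ a ]) (*-identityʳ (2 ^ n))

  μ-not : ∀ w → μ (map not w) ≡ map not (μ w)
  μ-not []          = refl
  μ-not (false ∷ w) = cong (λ v → true ∷ false ∷ v) (μ-not w)
  μ-not (true ∷ w)  = cong (λ v → false ∷ true ∷ v) (μ-not w)

  μ^-not : ∀ n w → μ^ n (map not w) ≡ map not (μ^ n w)
  μ^-not zero    w = refl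
  μ^-not (suc n) w = trans (cong μ (μ^-not n w)) (μ-not (μ^ n w))

  head-μ : ∀ w → head (μ w) ≡ head w
  head-μ []          = refl
  head-μ (false ∷ w) = refl
  head-μ (true ∷ w)  = refl

  head-μ^ : ∀ n w → head (μ^ n w) ≡ head w
  head-μ^ zero    w = refl
  head-μ^ (suc n) w = trans (head-μ (μ^ n w)) (head-μ^ n w)

  block-injective : ∀ n {a b} → block n a ≡ block n b → a ≡ b
  block-injective n {a} {b} eq with trans (sym (head-μ^ n [ a ])) (trans (cong head eq) (head-μ^ n [ b ]))
  ... | refl = refl

  block-distinct : ∀ n a → ¬ block n a ≡ block n (not a)
  block-distinct n false eq with block-injective n eq
  ... | ()
  block-distinct n true  eq with block-injective n eq
  ... | ()

  -- Cutting the image of a uniform morphism into blocks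

  take-prefix : ∀ {A : Set} (xs ys : List A) → take (length xs) (xs ++ ys) ≡ xs
  take-prefix []       ys = refl
  take-prefix (x ∷ xs) ys = cong (x ∷_) (take-prefix xs ys)

  drop-prefix : ∀ {A : Set} (xs ys : List A) → drop (length xs) (xs ++ ys) ≡ ys
  drop-prefix []       ys = refl
  drop-prefix (x ∷ xs) ys = drop-prefix xs ys

  blocks-concatMap : ∀ {b} (f : Bool → Word) → (∀ a → length (f a) ≡ b) →
    ∀ w → blocks b (length w) (concatMap f w) ≡ map f w
  blocks-concatMap f uniform []      = refl
  blocks-concatMap {b} f uniform (a ∷ w) = cong₂ _∷_ first-block other-blocks
    where
    fw = concatMap f w
    first-block : take b (f a ++ fw) ≡ f a
    first-block = subst (λ c → take c (f a ++ fw) ≡ f a) (uniform a) (take-prefix (f a) fw)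
    other-blocks : blocks b (length w) (drop b (f a ++ fw)) ≡ map f w
    other-blocks = begin
      blocks b (length w) (drop b (f a ++ fw))
        ≡⟨ cong (λ c → blocks b (length w) (drop c (f a ++ fw))) (sym (uniform a)) ⟩
      blocks b (length w) (drop (length (f a)) (f a ++ fw))
        ≡⟨ cong (blocks b (length w)) (drop-prefix (f a) fw) ⟩
      blocks b (length w) fw
        ≡⟨ blocks-concatMap f uniform w ⟩
      map f w
        ∎
      where open ≡-Reasoning

  blocks-μ^ : ∀ m w → blocks (2 ^ m) (length w) (μ^ m w) ≡ map (block m) w
  blocks-μ^ m w = trans (cong (blocks (2 ^ m) (length w)) (μ^-letterwise m w))
                        (blocks-concatMap (block m) (length-block m) w)

  -- Lengths of the pieces of CS(j+1)

  -- The length of the word assembled by `pieces` (the Bool is true at even positions).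
  pieceLength : Word → Bool → List (Word × Word) → ℕ
  pieceLength r even ps = length (concat (pieces r even ps))

  piece-even : ∀ r x y ps → pieceLength r true ((x , y) ∷ ps) ≡ length x + pieceLength r false ps
  piece-even r x y ps = length-++ x

  piece-odd-match : ∀ r x y ps → x ≡ y → pieceLength r false ((x , y) ∷ ps) ≡ length x + pieceLength r true ps
  piece-odd-match r x y ps x≡y with ≡-dec _≟ᵇ_ x y
  ... | yes _   = length-++ x
  ... | no x≢y = ⊥-elim (x≢y x≡y)

  piece-odd-mismatch : ∀ r x y ps → ¬ x ≡ y → pieceLength r false ((x , y) ∷ ps) ≡ length r + pieceLength r true ps
  piece-odd-mismatch r x y ps x≢y with ≡-dec _≟ᵇ_ x y
  ... | yes x≡y = ⊥-elim (x≢y x≡y)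
  ... | no _    = length-++ r

  -- The cost of a word t: the length of the word assembled from the pairs
  -- (μ^m(t_i), μ^m(¬t_{i+1})), where M = 2^m is the block length and R the
  -- length of the recursive piece.  An odd position costs M if the two blocks
  -- agree, i.e. if t_i ≠ t_{i+1}, and R otherwise.  The Bool argument of
  -- `cost` is true at even positions.
  oddCost : ℕ → ℕ → Bool → Bool → ℕ
  oddCost M R a b = if a xor b then M else R

  cost : ℕ → ℕ → Bool → Word → ℕ
  cost M R even  []            = 0
  cost M R even  (a ∷ [])      = 0
  cost M R true  (a ∷ b ∷ t) = M + cost M R false (b ∷ t)
  cost M R false (a ∷ b ∷ t) = oddCost M R a b + cost M R true (b ∷ t)

  blockPairs : ℕ → Word → List (Word × Word)
  blockPairs m t = zip (map (block m) t) (drop 1 (map (block m) (map not t)))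

  pieces-cost : ∀ m r even t →
    pieceLength r even (blockPairs m t) ≡ cost (2 ^ m) (length r) even t
  pieces-cost m r even  []            = refl
  pieces-cost m r even  (a ∷ [])      = refl
  pieces-cost m r true  (a ∷ b ∷ t) =
    trans (piece-even r (block m a) (block m (not b)) (blockPairs m (b ∷ t)))
          (cong₂ _+_ (length-block m a) (pieces-cost m r false (b ∷ t)))
  pieces-cost m r false (a ∷ b ∷ t) =
    trans (odd-piece a b) (cong (oddCost (2 ^ m) (length r) a b +_) (pieces-cost m r true (b ∷ t)))
    where
    rest = blockPairs m (b ∷ t)
    odd-piece : ∀ a b → pieceLength r false ((block m a , block m (not b)) ∷ rest)
                       ≡ oddCost (2 ^ m) (length r) a b + pieceLength r true rest
    odd-piece false false = piece-odd-mismatch r (block m false) (block m true) rest (block-distinct m false)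
    odd-piece false true  = trans (piece-odd-match r (block m false) (block m false) rest refl)
                                  (cong (_+ pieceLength r true rest) (length-block m false))
    odd-piece true  false = trans (piece-odd-match r (block m true) (block m true) rest refl)
                                  (cong (_+ pieceLength r true rest) (length-block m true))
    odd-piece true  true  = piece-odd-mismatch r (block m true) (block m false) rest (block-distinct m true)

  μ^-double : ∀ j w → μ^ (2 ^ suc j) w ≡ μ^ (2 ^ j) (μ^ (2 ^ j) w)
  μ^-double j w = trans (cong (λ e → μ^ (2 ^ j + e) w) (+-identityʳ (2 ^ j))) (μ^-+ (2 ^ j) (2 ^ j) w)

  length-CS-suc : ∀ j → length (CS (suc j)) ≡ cost (2 ^ (2 ^ j)) (length (CS j)) true (μ^ (2 ^ j) [ false ])
  length-CS-suc j = begin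
    length (CS (suc j))                                 ≡⟨ cong (λ ps → pieceLength (CS j) true ps) pairs ⟩
    pieceLength (CS j) true (blockPairs m t)            ≡⟨ pieces-cost m (CS j) true t ⟩
    cost (2 ^ m) (length (CS j)) true t                 ∎
    where
    open ≡-Reasoning
    m = 2 ^ j
    t = μ^ m [ false ]
    cut : ∀ v → length v ≡ 2 ^ m → blocks (2 ^ m) (2 ^ m) (μ^ m v) ≡ map (block m) v
    cut v |v| = subst (λ c → blocks (2 ^ m) c (μ^ m v) ≡ map (block m) v) |v| (blocks-μ^ m v)
    X-blocks : blocks (2 ^ m) (2 ^ m) (μ^ (2 ^ suc j) [ false ]) ≡ map (block m) t
    X-blocks = trans (cong (blocks (2 ^ m) (2 ^ m)) (μ^-double j [ false ])) (cut t (length-block m false))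
    Y-blocks : blocks (2 ^ m) (2 ^ m) (μ^ (2 ^ suc j) [ true ]) ≡ map (block m) (map not t)
    Y-blocks = trans (cong (blocks (2 ^ m) (2 ^ m)) (trans (μ^-double j [ true ]) (cong (μ^ m) (μ^-not m [ false ]))))
                     (cut (map not t) (trans (length-map not t) (length-block m false)))
    pairs : zip (blocks (2 ^ m) (2 ^ m) (μ^ (2 ^ suc j) [ false ])) (drop 1 (blocks (2 ^ m) (2 ^ m) (μ^ (2 ^ suc j) [ true ])))
            ≡ blockPairs m t
    pairs = cong₂ (λ xs ys → zip xs (drop 1 ys)) X-blocks Y-blocks

  -- Cost of the 8-letter blocks μ³(a) = a ā ā a ā a a ā

  regroup : ∀ M R x y → M + (R + (M + (M + (M + (R + (M + (x + y))))))) ≡ 5 * M + 2 * R + x + y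
  regroup = solve-∀

  regroup-last : ∀ M R → M + (R + (M + (M + (M + (R + (M + 0)))))) ≡ 5 * M + 2 * R
  regroup-last = solve-∀

  -- Inside μ³(a) the odd positions 1, 3, 5 cost R, M, R; position 7 is the
  -- junction with the first letter c of the next block.
  cost-block : ∀ M R a c w → cost M R true (block 3 a ++ block 3 c ++ w)
                 ≡ 5 * M + 2 * R + oddCost M R (not a) c + cost M R true (block 3 c ++ w)
  cost-block M R false false w = regroup M R (oddCost M R true false) (cost M R true (block 3 false ++ w))
  cost-block M R false true  w = regroup M R (oddCost M R true true) (cost M R true (block 3 true ++ w))
  cost-block M R true  false w = regroup M R (oddCost M R false false) (cost M R true (block 3 false ++ w))
  cost-block M R true  true  w = regroup M R (oddCost M R false true) (cost M R true (block 3 true ++ w))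

  -- The last block has no junction.
  cost-last-block : ∀ M R a → cost M R true (block 3 a ++ []) ≡ 5 * M + 2 * R
  cost-last-block M R false = regroup-last M R
  cost-last-block M R true  = regroup-last M R

  oddCost-lower : ∀ {M R ℓ} → ℓ ≤ M → ℓ ≤ R → ∀ a b → ℓ ≤ oddCost M R a b
  oddCost-lower ℓ≤M ℓ≤R a b with a xor b
  ... | true  = ℓ≤M
  ... | false = ℓ≤R

  -- Each 8-letter block of μ³(u) costs at least 5M + 2R + ℓ, counting the
  -- junction after it (the missing junction after the last block is the "+ ℓ").
  cost-μ³ : ∀ {M R ℓ} → ℓ ≤ M → ℓ ≤ R → ∀ u →
    length u * (5 * M + 2 * R + ℓ) ≤ cost M R true (concatMap (block 3) u) + ℓ
  cost-μ³ ℓ≤M ℓ≤R []      = z≤n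
  cost-μ³ {M} {R} {ℓ} ℓ≤M ℓ≤R (a ∷ []) = ≤-reflexive (begin
    (K + ℓ) + 0                             ≡⟨ +-identityʳ (K + ℓ) ⟩
    K + ℓ                                   ≡⟨ cong (_+ ℓ) (sym (cost-last-block M R a)) ⟩
    cost M R true (block 3 a ++ []) + ℓ     ∎)
    where
    open ≡-Reasoning
    K = 5 * M + 2 * R
  cost-μ³ {M} {R} {ℓ} ℓ≤M ℓ≤R (a ∷ c ∷ u) = begin
    (K + ℓ) + length (c ∷ u) * (K + ℓ)      ≤⟨ +-monoʳ-≤ (K + ℓ) (cost-μ³ ℓ≤M ℓ≤R (c ∷ u)) ⟩
    (K + ℓ) + (C + ℓ)                       ≡⟨ sym (+-assoc (K + ℓ) C ℓ) ⟩
    (K + ℓ + C) + ℓ                         ≤⟨ +-monoˡ-≤ ℓ (+-monoˡ-≤ C (+-monoʳ-≤ K (oddCost-lower ℓ≤M ℓ≤R (not a) c))) ⟩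
    (K + oddCost M R (not a) c + C) + ℓ     ≡⟨ cong (_+ ℓ) (sym (cost-block M R a c (concatMap (block 3) u))) ⟩
    cost M R true (concatMap (block 3) (a ∷ c ∷ u)) + ℓ ∎
    where
    open ≤-Reasoning
    K = 5 * M + 2 * R
    C = cost M R true (concatMap (block 3) (c ∷ u))

  -- The counting bound at level j+1, for j ≥ 2 (so that t splits into
  -- 8-letter blocks); M = 2^(2^j) and R = |CS(j)|.
  length-CS-suc-lower : ∀ j → 3 ≤ 2 ^ j → ∀ {ℓ} → ℓ ≤ 2 ^ (2 ^ j) → ℓ ≤ length (CS j) →
    let M = 2 ^ (2 ^ j); R = length (CS j) in
    M * (5 * M + 2 * R + ℓ) ≤ 8 * (length (CS (suc j)) + ℓ)
  length-CS-suc-lower j 3≤m {ℓ} ℓ≤M ℓ≤R = begin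
    M * (K + ℓ)                             ≡⟨ cong (_* (K + ℓ)) M≡8|u| ⟩
    8 * length u * (K + ℓ)                  ≡⟨ *-assoc 8 (length u) (K + ℓ) ⟩
    8 * (length u * (K + ℓ))                ≤⟨ *-monoʳ-≤ 8 (cost-μ³ ℓ≤M ℓ≤R u) ⟩
    8 * (cost M R true (concatMap (block 3) u) + ℓ)
                                            ≡⟨ cong (λ v → 8 * (cost M R true v + ℓ)) (sym t≡concat) ⟩
    8 * (cost M R true t + ℓ)               ≡⟨ cong (λ L → 8 * (L + ℓ)) (sym (length-CS-suc j)) ⟩
    8 * (length (CS (suc j)) + ℓ)           ∎
    where
    open ≤-Reasoning
    m = 2 ^ j
    M = 2 ^ m
    R = length (CS j)
    K = 5 * M + 2 * R
    t = μ^ m [ false ]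
    u = μ^ (m ∸ 3) [ false ]
    t≡μ³u : t ≡ μ^ 3 u
    t≡μ³u = trans (cong (λ e → μ^ e [ false ]) (sym (m+[n∸m]≡n 3≤m))) (μ^-+ 3 (m ∸ 3) [ false ])
    t≡concat : t ≡ concatMap (block 3) u
    t≡concat = trans t≡μ³u (μ^-letterwise 3 u)
    M≡8|u| : M ≡ 8 * length u
    M≡8|u| = trans (sym (length-block m false)) (trans (cong length t≡μ³u) (length-μ^ 3 u))

  -- Arithmetic of one induction step

  -- If R ≥ M the level-(j+1) word is almost saturated: |CS(j+1)| ≥ M² - M.
  saturated-step : ∀ {m M R L} → m ≤ M → M ≤ R → M * (5 * M + 2 * R + M) ≤ 8 * (L + M) →
    m * (M * M) ≤ m * L + M * M
  saturated-step {m} {M} {R} {L} m≤M M≤R counted = begin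
    m * (M * M)       ≤⟨ *-monoʳ-≤ m M²≤L+M ⟩
    m * (L + M)       ≡⟨ *-distribˡ-+ m L M ⟩
    m * L + m * M     ≤⟨ +-monoʳ-≤ (m * L) (*-monoˡ-≤ M m≤M) ⟩
    m * L + M * M     ∎
    where
    open ≤-Reasoning
    eight : ∀ M → 8 * (M * M) ≡ M * (5 * M + 2 * M + M)
    eight = solve-∀
    M²≤L+M : M * M ≤ L + M
    M²≤L+M = *-cancelˡ-≤ 8 (begin
      8 * (M * M)                ≡⟨ eight M ⟩
      M * (5 * M + 2 * M + M)    ≤⟨ *-monoʳ-≤ M (+-monoˡ-≤ M (+-monoʳ-≤ (5 * M) (*-monoʳ-≤ 2 M≤R))) ⟩
      M * (5 * M + 2 * R + M)    ≤⟨ counted ⟩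
      8 * (L + M)                ∎)

  -- Otherwise the induction hypothesis m·M ≤ m·R + 2M is used, multiplied by
  -- 3M - 8 = 3d + 16 where M = 8 + d.
  recursive-step : ∀ {m M R L} → 8 ≤ M → 4 * m ≤ M + 8 → m * M ≤ m * R + 2 * M →
    M * (5 * M + 2 * R + R) ≤ 8 * (L + R) → m * (M * M) ≤ m * L + M * M
  recursive-step {m} {_} {R} {L} 8≤M 4m≤M+8 ih counted with m≤n⇒∃[o]m+o≡n 8≤M
  ... | d , refl = *-cancelˡ-≤ 8 (+-cancelʳ-≤ E (8 * (m * (M * M))) (8 * (m * L + M * M)) (begin
    8 * (m * (M * M)) + E
      ≡⟨ split m d R ⟩
    5 * (m * (M * M)) + (3 * d + 16) * (m * M) + 8 * (m * M) + 8 * (m * R) + 16 * M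
      ≤⟨ +-monoˡ-≤ (16 * M) (+-monoˡ-≤ (8 * (m * R)) (+-monoˡ-≤ (8 * (m * M))
           (+-monoʳ-≤ (5 * (m * (M * M))) (*-monoʳ-≤ (3 * d + 16) ih)))) ⟩
    5 * (m * (M * M)) + (3 * d + 16) * (m * R + 2 * M) + 8 * (m * M) + 8 * (m * R) + 16 * M
      ≡⟨ merge m d R ⟩
    m * (M * (5 * M + 2 * R + R)) + 2 * M * (4 * m) + 6 * (M * M)
      ≤⟨ +-monoˡ-≤ (6 * (M * M)) (+-mono-≤ (*-monoʳ-≤ m counted) (*-monoʳ-≤ (2 * M) 4m≤M+8)) ⟩
    m * (8 * (L + R)) + 2 * M * (M + 8) + 6 * (M * M)
      ≡⟨ collect m d R L ⟩
    8 * (m * L + M * M) + E ∎))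
    where
    open ≤-Reasoning
    M = 8 + d
    E = 8 * (m * R) + 16 * M
    split : ∀ m d R → 8 * (m * ((8 + d) * (8 + d))) + (8 * (m * R) + 16 * (8 + d))
      ≡ 5 * (m * ((8 + d) * (8 + d))) + (3 * d + 16) * (m * (8 + d)) + 8 * (m * (8 + d)) + 8 * (m * R) + 16 * (8 + d)
    split = solve-∀
    merge : ∀ m d R → 5 * (m * ((8 + d) * (8 + d))) + (3 * d + 16) * (m * R + 2 * (8 + d)) + 8 * (m * (8 + d)) + 8 * (m * R) + 16 * (8 + d)
      ≡ m * ((8 + d) * (5 * (8 + d) + 2 * R + R)) + 2 * (8 + d) * (4 * m) + 6 * ((8 + d) * (8 + d))
    merge = solve-∀
    collect : ∀ m d R L → m * (8 * (L + R)) + 2 * (8 + d) * ((8 + d) + 8) + 6 * ((8 + d) * (8 + d))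
      ≡ 8 * (m * L + (8 + d) * (8 + d)) + (8 * (m * R) + 16 * (8 + d))
    collect = solve-∀

  n<2^n : ∀ n → n < 2 ^ n
  n<2^n zero    = s≤s z≤n
  n<2^n (suc n) = +-mono-≤ (m^n>0 2 n) (≤-trans (n<2^n n) (≤-reflexive (sym (+-identityʳ (2 ^ n)))))

  4n≤2^n+8 : ∀ n → 4 * n ≤ 2 ^ n + 8
  4n≤2^n+8 zero          = z≤n
  4n≤2^n+8 (suc zero)    = toWitness {a? = 4 ≤? 10} _
  4n≤2^n+8 (suc (suc n)) = begin
    4 * (2 + n)        ≡⟨ shift n ⟩
    4 * n + 8          ≤⟨ +-monoˡ-≤ 8 (*-monoʳ-≤ 4 (<⇒≤ (n<2^n n))) ⟩
    4 * 2 ^ n + 8      ≡⟨ cong (_+ 8) (quadruple (2 ^ n)) ⟩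
    2 ^ (2 + n) + 8    ∎
    where
    open ≤-Reasoning
    shift : ∀ n → 4 * (2 + n) ≡ 4 * n + 8
    shift = solve-∀
    quadruple : ∀ x → 4 * x ≡ 2 * (2 * x)
    quadruple = solve-∀

  -- The induction

  -- The theorem with the denominator n = 2^k cleared.
  Bound : ℕ → Set
  Bound k = 2 ^ k * 2 ^ (2 ^ k) ≤ 2 ^ k * length (CS k) + 2 * 2 ^ (2 ^ k)

  -- At level j+1 we have n = 2m and 2^n = M², so the bound halves to m·M² ≤ m·L + M².
  Bound-suc : ∀ j → let m = 2 ^ j; M = 2 ^ m in
    m * (M * M) ≤ m * length (CS (suc j)) + M * M → Bound (suc j)
  Bound-suc j halved = begin
    2 * m * 2 ^ (2 * m)               ≡⟨ cong (2 * m *_) square ⟩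
    2 * m * (M * M)                   ≡⟨ *-assoc 2 m (M * M) ⟩
    2 * (m * (M * M))                 ≤⟨ *-monoʳ-≤ 2 halved ⟩
    2 * (m * L + M * M)               ≡⟨ double m L (M * M) ⟩
    2 * m * L + 2 * (M * M)           ≡⟨ cong (λ Q → 2 * m * L + 2 * Q) (sym square) ⟩
    2 * m * L + 2 * 2 ^ (2 * m)       ∎
    where
    open ≤-Reasoning
    m = 2 ^ j
    M = 2 ^ m
    L = length (CS (suc j))
    square : 2 ^ (2 * m) ≡ M * M
    square = trans (cong (λ e → 2 ^ (m + e)) (+-identityʳ m)) (^-distribˡ-+-* 2 m m)
    double : ∀ m L Q → 2 * (m * L + Q) ≡ 2 * m * L + 2 * Q
    double = solve-∀

  level-step : ∀ j → 3 ≤ 2 ^ j → Bound j → Bound (suc j)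
  level-step j 3≤m ih with 2 ^ (2 ^ j) ≤? length (CS j)
  ... | yes M≤R = Bound-suc j (saturated-step (<⇒≤ (n<2^n (2 ^ j))) M≤R (length-CS-suc-lower j 3≤m ≤-refl M≤R))
  ... | no  M≰R = Bound-suc j (recursive-step {m = 2 ^ j} (^-monoʳ-≤ 2 3≤m) (4n≤2^n+8 (2 ^ j)) ih
                                  (length-CS-suc-lower j 3≤m (≰⇒≥ M≰R) ≤-refl))

  bound : ∀ k → Bound k
  bound 0 = toWitness {a? = _ ≤? _} _
  bound 1 = toWitness {a? = _ ≤? _} _
  bound 2 = toWitness {a? = _ ≤? _} _
  bound (suc (suc (suc i))) = level-step (2 + i) (≤-trans (m≤m+n 3 i) (n<2^n (2 + i))) (bound (suc (suc i)))

-- The transfer to ℚ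

open import Data.Integer using (+_)
open import Data.Rational using (_/_; _*_; _-_; _≤_; 1ℚ; toℚᵘ; -_)
open import Data.Nat as ℕ using (suc)
import Data.Nat.Properties as ℕ
import Data.Integer as ℤ
import Data.Integer.Properties as ℤ
open import Data.Integer.Tactic.RingSolver using (solve-∀)
open import Data.Rational.Properties
  using (toℚᵘ-cancel-≤; toℚᵘ-homo-*; toℚᵘ-homo-+; toℚᵘ-homo‿-; toℚᵘ-fromℚᵘ)
import Data.Rational.Unnormalised as ℚᵘ
import Data.Rational.Unnormalised.Properties as ℚᵘ
open import Relation.Binary.PropositionalEquality using (_≡_; subst₂; cong; cong₂; sym; trans)

-- It is checked on the
-- unnormalised representatives, where ≤ is cross-multiplication in ℤ.
clear-denominator : ∀ N L K .{{_ : ℕ.NonZero K}} → K ℕ.* N ℕ.≤ K ℕ.* L ℕ.+ 2 ℕ.* N →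
  (+ N / 1) * (1ℚ - (+ 2) / K) ≤ (+ L / 1)
clear-denominator N L (suc K) KN≤KL+2N =
  toℚᵘ-cancel-≤ (ℚᵘ.≤-respˡ-≃ (ℚᵘ.≃-sym lhs≃) (ℚᵘ.≤-respʳ-≃ (ℚᵘ.≃-sym (toℚᵘ-fromℚᵘ (+ L ℚᵘ./ 1))) unnormalised))
  where
  two/K = (+ 2) / suc K
  lhs≃ : toℚᵘ ((+ N / 1) * (1ℚ - two/K)) ℚᵘ.≃ (+ N ℚᵘ./ 1) ℚᵘ.* (ℚᵘ.1ℚᵘ ℚᵘ.- (+ 2 ℚᵘ./ suc K))
  lhs≃ = ℚᵘ.≃-trans (toℚᵘ-homo-* (+ N / 1) (1ℚ - two/K)) (ℚᵘ.*-cong (toℚᵘ-fromℚᵘ (+ N ℚᵘ./ 1))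
           (ℚᵘ.≃-trans (toℚᵘ-homo-+ 1ℚ (- two/K)) (ℚᵘ.+-cong ℚᵘ.≃-refl
             (ℚᵘ.≃-trans (toℚᵘ-homo‿- two/K) (ℚᵘ.-‿cong (toℚᵘ-fromℚᵘ (+ 2 ℚᵘ./ suc K)))))))
  KN≤KL+2Nᶻ : + suc K ℤ.* + N ℤ.≤ + suc K ℤ.* + L ℤ.+ + 2 ℤ.* + N
  KN≤KL+2Nᶻ = subst₂ ℤ._≤_ (ℤ.pos-* (suc K) N)
    (trans (ℤ.pos-+ (suc K ℕ.* L) (2 ℕ.* N)) (cong₂ ℤ._+_ (ℤ.pos-* (suc K) L) (ℤ.pos-* 2 N)))
    (ℤ.+≤+ KN≤KL+2N)
  lhs-form : ∀ n k → k ℤ.* n ℤ.+ ℤ.- (+ 2 ℤ.* n) ≡ n ℤ.* (+ 1 ℤ.* k ℤ.+ ℤ.- + 2 ℤ.* + 1) ℤ.* + 1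
  lhs-form = solve-∀
  rhs-form : ∀ l k n → k ℤ.* l ℤ.+ + 2 ℤ.* n ℤ.+ ℤ.- (+ 2 ℤ.* n) ≡ l ℤ.* k
  rhs-form = solve-∀
  denominator : + L ℤ.* + suc K ≡ + L ℤ.* + (1 ℕ.* (1 ℕ.* suc K))
  denominator = cong (λ d → + L ℤ.* + d) (sym (trans (ℕ.*-identityˡ (1 ℕ.* suc K)) (ℕ.*-identityˡ (suc K))))
  unnormalised : (+ N ℚᵘ./ 1) ℚᵘ.* (ℚᵘ.1ℚᵘ ℚᵘ.- (+ 2 ℚᵘ./ suc K)) ℚᵘ.≤ (+ L ℚᵘ./ 1)
  unnormalised = ℚᵘ.*≤* (subst₂ ℤ._≤_ (lhs-form (+ N) (+ suc K)) (trans (rhs-form (+ L) (+ suc K) (+ N)) denominator)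
                   (ℤ.+-monoˡ-≤ (ℤ.- (+ 2 ℤ.* + N)) KN≤KL+2Nᶻ))

theorem1 : (k : ℕ) →
    (+ (2 ^ (2 ^ k)) / 1) * (1ℚ - _/_ (+ 2) (2 ^ k) {{m^n≢0 2 k}}) ≤ (+ length (CS k) / 1)
theorem1 k = clear-denominator (2 ^ (2 ^ k)) (length (CS k)) (2 ^ k) {{m^n≢0 2 k}} (LowerBound.bound k)
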